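{- Let $(\alpha_n)_{n\ge0}$ be a sequence of complex numbers, $A_n(x)=\sum_{\nu=0}^{n}\binom{n}{\nu}\alpha_{n-\nu}x^\nu$, and for $n\ge0$, $k\in\mathbb{Z}$ let $G_{n,k}(x)=x^kA_n(x^{ -1})$. For $0\le j\le n$ let $a_{n,j}=\sum_{\nu=j}^{n}\binom{n}{\nu}\binom{\nu}{j}\alpha_\nu$, $C_n(x)=\sum_{j=0}^{n}a_{n,j}x^j$, and let $C_{n,k}(x)$ be the formal power series $C_n(x)(x+1)^{k-n}=C_n(x)\sum_{\nu\ge0}\binom{k-n}{\nu}x^\nu$. Then for $n\ge0$, $k\in\mathbb{Z}$, $C_{n,k}(x)=G_{n,k}(x+1)$, where $|x|<1$ is required for convergence if $k<n$; if $k\ge n$, $C_{n,k}(x)$ is a polynomial. For $n,k\ge\ell\ge0$, $$[x^\ell]\,C_{n,k}(x)=\frac{1}{\ell!}G_{n,k}^{(\ell)}(1)=\sum_{\nu=0}^{\ell}\binom{k-n}{\ell-\nu}a_{n,\nu}.$$ If moreover $A_m(1-x)=(-1)^mA_m(x)$ for all $m\ge0$, then for $k\ge n\ge0$, $C_{n,k}(x)=(-1)^nx^kC_{n,k}(x^{ -1})$; and if in addition $n$ is odd and $k$ is even, then $[x^{k/2}]\,C_{n,k}(x)=0$.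
   Context: $\alpha_0=0$ is allowed. Binomial coefficients $\binom{c}{\nu}$ with negative integer $c$ are generalized binomial coefficients $c(c-1)\cdots(c-\nu+1)/\nu!$. $[x^\ell]$ denotes the coefficient of $x^\ell$ in a formal power series. -}

module Defs where

open import Level using (_⊔_)
open import Algebra.Bundles using (CommutativeRing)
open import Data.Nat as ℕ using (ℕ; zero; suc; _∸_; _≤ᵇ_; _!)
open import Data.Nat.Properties using (_!≢0)
open import Data.Nat.Combinatorics using (_C_)
open import Data.Integer as ℤ using (ℤ; +_; -[1+_]; _/ℕ_)
open import Data.Bool using (if_then_else_)
open import Data.List using (List; []; _∷_; map; upTo)
open import Data.Product using (_×_; _,_)
open import Function using (_∘_)

fallingℤ : ℤ → ℕ → ℤ
fallingℤ c zero    = + 1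
fallingℤ c (suc ν) = fallingℤ c ν ℤ.* (c ℤ.- + ν)

gbinom : ℤ → ℕ → ℤ
gbinom c ν = _/ℕ_ (fallingℤ c ν) (ν !) {{ν !≢0}}

module Series {c ℓ} (R : CommutativeRing c ℓ) where
  open CommutativeRing R

  ιℕ : ℕ → Carrier
  ιℕ zero    = 0#
  ιℕ (suc n) = 1# + ιℕ n

  ιℤ : ℤ → Carrier
  ιℤ (+ n)     = ιℕ n
  ιℤ -[1+ n ]  = - ιℕ (suc n)

  sgn : ℕ → Carrier
  sgn zero    = 1#
  sgn (suc m) = - sgn m

  -- R has no additive torsion (true for ℂ)
  TorsionFree : Set (c ⊔ ℓ)
  TorsionFree = ∀ m x → ιℕ (suc m) * x ≈ 0# → x ≈ 0#

  Σ< : ℕ → (ℕ → Carrier) → Carrier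
  Σ< zero    f = 0#
  Σ< (suc n) f = Σ< n f + f n

  -- formal power series (and polynomials) as coefficient sequences
  FPS : Set c
  FPS = ℕ → Carrier

  _≋_ : FPS → FPS → Set ℓ
  f ≋ g = ∀ i → f i ≈ g i

  _⋆_ : FPS → FPS → FPS
  (f ⋆ g) n = Σ< (suc n) (λ i → f i * g (n ∸ i))

  one : FPS
  one zero    = 1#
  one (suc _) = 0#

  powS : FPS → ℕ → FPS
  powS f zero    = one
  powS f (suc n) = f ⋆ powS f n

  oneMinusX : FPS
  oneMinusX zero          = 1#
  oneMinusX (suc zero)    = - 1#
  oneMinusX (suc (suc _)) = 0#

  -- x^k p(x^{-1}) for a polynomial p of degree ≤ k
  reflect : ℕ → FPS → FPS
  reflect k f ℓ' = if ℓ' ≤ᵇ k then f (k ∸ ℓ') else 0#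

  Laurent : Set c
  Laurent = List (Carrier × ℤ)

  deriv : Laurent → Laurent
  deriv = map (λ { (a , e) → (ιℤ e * a , e ℤ.- + 1) })

  derivN : ℕ → Laurent → Laurent
  derivN zero    L = L
  derivN (suc n) L = deriv (derivN n L)

  evalAt1 : Laurent → Carrier
  evalAt1 []             = 0#
  evalAt1 ((a , e) ∷ L)  = a + evalAt1 L

  -- L(x+1) as a formal power series in x, with (x+1)^e = Σ_i binom(e,i) x^i
  -- (the expansion valid for |x| < 1 when e < 0)
  at1+x : Laurent → FPS
  at1+x []            i = 0#
  at1+x ((a , e) ∷ L) i = a * ιℤ (gbinom e i) + at1+x L i

  module Paper (α : ℕ → Carrier) where
    -- A_n(x) = Σ_{ν=0}^n binom(n,ν) α_{n-ν} x^ν   (coefficient vanishes for ν > n)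
    A : ℕ → FPS
    A n ν = ιℕ (n C ν) * α (n ∸ ν)

    AatOneMinusX : ℕ → FPS
    AatOneMinusX m j = Σ< (suc m) (λ ν → A m ν * powS oneMinusX ν j)

    -- G_{n,k}(x) = x^k A_n(x^{-1}) = Σ_{ν=0}^n [x^ν]A_n · x^{k-ν}
    G : ℕ → ℤ → Laurent
    G n k = map (λ ν → (A n ν , k ℤ.- + ν)) (upTo (suc n))

    a : ℕ → ℕ → Carrier
    a n j = Σ< (suc n ∸ j) (λ i → ιℕ (n C (j ℕ.+ i)) * ιℕ ((j ℕ.+ i) C j) * α (j ℕ.+ i))

    Cpoly : ℕ → FPS
    Cpoly n j = if j ≤ᵇ n then a n j else 0#

    Cnk : ℕ → ℤ → FPS
    Cnk n k = Cpoly n ⋆ (λ ν → ιℤ (gbinom (k ℤ.- + n) ν))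

{-# OPTIONS --safe #-}
module Submission where

-- Both C_{n,k}(x) and G_{n,k}(x + 1) expand to Σ_μ binom(n,μ) α_μ (1 + x)^(k-n+μ): for C_{n,k} by
-- Vandermonde's convolution of binom(μ,j) with binom(k-n,i-j), for G_{n,k} by reindexing ν = n - μ. Since binom(e,i) i! is the falling factorial e(e-1)⋯(e-i+1),
-- the i-th coefficient of L(1 + x) is L⁽ⁱ⁾(1)/i! for every Laurent polynomial L. For k = K ≥ n the
-- coefficients are Σ_ν [x^ν]A_n binom(K-ν,i); inserting A_n(1-x) = (-1)^n A_n(x) and the identity
-- Σ_j [x^j](1-x)^ν binom(K-j,K-i) = binom(K-ν,i) turns the (K-i)-th coefficient into (-1)^n times the
-- i-th. For odd n the middle coefficient is then its own negative, hence 0 in a torsion-free ring.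
-- Generalised binomial coefficients are computed by an integer-valued binom defined by Pascal's rule,
-- which agrees with gbinom because fallingℤ c i = i! binom c i.

open import Defs
open import Algebra.Bundles using (CommutativeRing)
open import Data.Bool using (true; false; if_then_else_)
open import Data.Empty using (⊥-elim)
open import Data.List using ([]; _∷_; map; applyUpTo)
open import Data.Nat as ℕ using (ℕ; zero; suc; _≤_; _<_; _∸_; _!; z≤n; s≤s)
open import Data.Nat.Properties as ℕP using (_!≢0)
open import Data.Nat.Combinatorics using (_C_; nCk+nC[k+1]≡[n+1]C[k+1]; k>n⇒nCk≡0; nCk≡nC[n∸k])
open import Data.Integer as ℤ using (ℤ; +_; -[1+_]; 0ℤ; 1ℤ; +≤+; +<+)
open import Data.Integer.Properties as ℤP using ()
import Algebra.Properties.CommutativeSemigroup ℤP.+-commutativeSemigroup as ℤ+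
open import Data.Product using (_×_; _,_; proj₁; proj₂)
open import Relation.Binary.PropositionalEquality as ≡ using (_≡_)
open import Relation.Nullary using (yes; no)

if-≤ᵇ-of-≤ : ∀ {a} {A : Set a} {i n} {x y : A} → i ≤ n → (if i ℕ.≤ᵇ n then x else y) ≡ x
if-≤ᵇ-of-≤ {i = i} {n} i≤n with i ℕ.≤ᵇ n | ℕP.≤⇒≤ᵇ i≤n
... | true | _ = ≡.refl

if-≤ᵇ-of-> : ∀ {a} {A : Set a} {i n} {x y : A} → n < i → (if i ℕ.≤ᵇ n then x else y) ≡ y
if-≤ᵇ-of-> {i = i} {n} n<i with i ℕ.≤ᵇ n | ℕP.≤ᵇ⇒≤ i n
... | true  | i≤n = ⊥-elim (ℕP.<⇒≱ n<i (i≤n _))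
... | false | _   = ≡.refl

module Binomial where
  open import Data.Nat.DivMod using (m*n/n≡m; m*n%n≡0)
  open import Data.Integer using (_/ℕ_; _+_; _-_; _*_; -_)
  open import Data.Integer.Properties using (pos-*; i-j≡0⇒i≡j)
  open import Data.Integer.Tactic.RingSolver using (solve-∀)
  open ≡ using (refl; sym; trans; cong; cong₂; subst)
  open ≡.≡-Reasoning

  -- binom(-1-m, i), by the Pascal rule solved for its first summand
  negBinom : ℕ → ℕ → ℤ
  negBinom m       zero    = 1ℤ
  negBinom zero    (suc i) = - negBinom zero i
  negBinom (suc m) (suc i) = negBinom m (suc i) - negBinom (suc m) i

  binom : ℤ → ℕ → ℤ
  binom (+ n)    i = + (n C i)
  binom -[1+ m ] i = negBinom m i

  binom-0 : ∀ c → binom c 0 ≡ 1ℤ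
  binom-0 (+ n)    = refl
  binom-0 -[1+ m ] = refl

  binom-pascal : ∀ c i → binom (1ℤ + c) (suc i) ≡ binom c (suc i) + binom c i
  binom-pascal (+ n) i = begin
    + (suc n C suc i)          ≡⟨ cong +_ (nCk+nC[k+1]≡[n+1]C[k+1] n i) ⟨
    + (n C i ℕ.+ n C suc i)    ≡⟨ ℤP.pos-+ (n C i) (n C suc i) ⟩
    + (n C i) + + (n C suc i)  ≡⟨ ℤP.+-comm (+ (n C i)) (+ (n C suc i)) ⟩
    + (n C suc i) + + (n C i)  ∎
  binom-pascal -[1+ zero ]  i = sym (ℤP.+-inverseˡ (negBinom zero i))
  binom-pascal -[1+ suc m ] i = x≡[x-y]+y (negBinom m (suc i)) (negBinom (suc m) i)
    where
    x≡[x-y]+y : ∀ x y → x ≡ (x - y) + y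
    x≡[x-y]+y = solve-∀

  binom-> : ∀ {n i} → n ℕ.< i → binom (+ n) i ≡ 0ℤ
  binom-> n<i = cong +_ (k>n⇒nCk≡0 n<i)

  fallingℤ-pascal : ∀ c i → fallingℤ (1ℤ + c) (suc i) ≡ fallingℤ c (suc i) + + suc i * fallingℤ c i
  fallingℤ-pascal c zero = [1+c]-0≡[c-0]+1 c
    where
    [1+c]-0≡[c-0]+1 : ∀ c → 1ℤ * ((1ℤ + c) - 0ℤ) ≡ 1ℤ * (c - 0ℤ) + (1ℤ + 0ℤ) * 1ℤ
    [1+c]-0≡[c-0]+1 = solve-∀
  fallingℤ-pascal c (suc i) = begin
    fallingℤ (1ℤ + c) (suc i) * ((1ℤ + c) - + suc i)
      ≡⟨ cong (_* ((1ℤ + c) - + suc i)) (fallingℤ-pascal c i) ⟩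
    (fallingℤ c (suc i) + + suc i * fallingℤ c i) * ((1ℤ + c) - + suc i)
      ≡⟨ pascal-step c (fallingℤ c i) (+ i) ⟩
    fallingℤ c (suc i) * (c - + suc i) + + suc (suc i) * fallingℤ c (suc i) ∎
    where
    pascal-step : ∀ c F p → (F * (c - p) + (1ℤ + p) * F) * ((1ℤ + c) - (1ℤ + p))
                    ≡ F * (c - p) * (c - (1ℤ + p)) + (1ℤ + (1ℤ + p)) * (F * (c - p))
    pascal-step = solve-∀

  fallingℤ-0 : ∀ i → fallingℤ 0ℤ (suc i) ≡ 0ℤ
  fallingℤ-0 zero    = refl
  fallingℤ-0 (suc i) = cong (_* (0ℤ - + suc i)) (fallingℤ-0 i)

  binom-defect : ℤ → ℕ → ℤ
  binom-defect c i = fallingℤ c i - + (i !) * binom c i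

  -- Both terms satisfy the same Pascal rule, so the defect does not change under c ↦ 1 + c.
  binom-defect-shift : ∀ c i → binom-defect c i ≡ 0ℤ → binom-defect (1ℤ + c) (suc i) ≡ binom-defect c (suc i)
  binom-defect-shift c i defect≡0 = begin
    fallingℤ (1ℤ + c) (suc i) - + (suc i !) * binom (1ℤ + c) (suc i)
      ≡⟨ cong₂ _-_ (fallingℤ-pascal c i) (cong₂ _*_ (pos-* (suc i) (i !)) (binom-pascal c i)) ⟩
    (F + s * fallingℤ c i) - s * f * (b₁ + b₀)
      ≡⟨ cong (λ z → (F + s * z) - s * f * (b₁ + b₀)) (i-j≡0⇒i≡j _ _ defect≡0) ⟩
    (F + s * (f * b₀)) - s * f * (b₁ + b₀)
      ≡⟨ cancel-b₀ F s f b₁ b₀ ⟩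
    F - s * f * b₁
      ≡⟨ cong (λ z → F - z * b₁) (pos-* (suc i) (i !)) ⟨
    F - + (suc i !) * b₁ ∎
    where
    F s f b₁ b₀ : ℤ
    F = fallingℤ c (suc i)
    s = + suc i
    f = + (i !)
    b₁ = binom c (suc i)
    b₀ = binom c i
    cancel-b₀ : ∀ F s f b₁ b₀ → (F + s * (f * b₀)) - s * f * (b₁ + b₀) ≡ F - s * f * b₁
    cancel-b₀ = solve-∀

  binom-defect≡0 : ∀ i c → binom-defect c i ≡ 0ℤ
  binom-defect≡0 zero c = begin
    1ℤ - 1ℤ * binom c 0 ≡⟨ cong (λ b → 1ℤ - 1ℤ * b) (binom-0 c) ⟩
    1ℤ - 1ℤ * 1ℤ       ≡⟨⟩
    0ℤ                 ∎
  binom-defect≡0 (suc i) = go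
    where
    shift : ∀ c → binom-defect (1ℤ + c) (suc i) ≡ binom-defect c (suc i)
    shift c = binom-defect-shift c i (binom-defect≡0 i c)
    nonneg : ∀ n → binom-defect (+ n) (suc i) ≡ 0ℤ
    nonneg zero    = cong₂ _-_ (fallingℤ-0 i) (ℤP.*-zeroʳ (+ (suc i !)))
    nonneg (suc n) = trans (shift (+ n)) (nonneg n)
    neg : ∀ m → binom-defect -[1+ m ] (suc i) ≡ 0ℤ
    neg zero    = trans (sym (shift -[1+ zero ])) (nonneg zero)
    neg (suc m) = trans (sym (shift -[1+ suc m ])) (neg m)
    go : ∀ c → binom-defect c (suc i) ≡ 0ℤ
    go (+ n)    = nonneg n
    go -[1+ m ] = neg m

  fallingℤ≡!*binom : ∀ i c → fallingℤ c i ≡ + (i !) * binom c i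
  fallingℤ≡!*binom i c = i-j≡0⇒i≡j _ _ (binom-defect≡0 i c)

  d*z/ℕd≡z : ∀ d z .{{_ : ℕ.NonZero d}} → (+ d * z) /ℕ d ≡ z
  d*z/ℕd≡z d (+ n) = begin
    (+ d * + n) /ℕ d   ≡⟨ cong (_/ℕ d) (pos-* d n) ⟨
    + ((d ℕ.* n) ℕ./ d) ≡⟨ cong (λ m → + (m ℕ./ d)) (ℕP.*-comm d n) ⟩
    + ((n ℕ.* d) ℕ./ d) ≡⟨ cong +_ (m*n/n≡m n d) ⟩
    + n                 ∎
  d*z/ℕd≡z (suc d) -[1+ n ] = begin
    -[1+ k ] /ℕ suc d                 ≡⟨ -[1+k]/ℕd≡-[[1+k]/d] k (suc d) d∣1+k ⟩
    - + ((suc d ℕ.* suc n) ℕ./ suc d) ≡⟨ cong (λ m → - + (m ℕ./ suc d)) d*n≡n*d ⟩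
    - + ((suc n ℕ.* suc d) ℕ./ suc d) ≡⟨ cong (λ m → - + m) (m*n/n≡m (suc n) (suc d)) ⟩
    -[1+ n ]                          ∎
    where
    k : ℕ
    k = n ℕ.+ d ℕ.* suc n
    d*n≡n*d : suc d ℕ.* suc n ≡ suc n ℕ.* suc d
    d*n≡n*d = ℕP.*-comm (suc d) (suc n)
    d∣1+k : suc k ℕ.% suc d ≡ 0
    d∣1+k = trans (cong (ℕ._% suc d) d*n≡n*d) (m*n%n≡0 (suc n) (suc d))
    -[1+k]/ℕd≡-[[1+k]/d] : ∀ k d .{{_ : ℕ.NonZero d}} → suc k ℕ.% d ≡ 0 → -[1+ k ] /ℕ d ≡ - + (suc k ℕ./ d)
    -[1+k]/ℕd≡-[[1+k]/d] k d d∣1+k rewrite d∣1+k = refl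

  gbinom≡binom : ∀ c i → gbinom c i ≡ binom c i
  gbinom≡binom c i = begin
    _/ℕ_ (fallingℤ c i) (i !) {{i !≢0}}            ≡⟨ cong (λ z → _/ℕ_ z (i !) {{i !≢0}}) (fallingℤ≡!*binom i c) ⟩
    _/ℕ_ (+ (i !) * binom c i) (i !) {{i !≢0}}    ≡⟨ d*z/ℕd≡z (i !) (binom c i) {{i !≢0}} ⟩
    binom c i                                     ∎

  i-[1+j]≡i-1-j : ∀ i j → i - (1ℤ + j) ≡ (i - 1ℤ) - j
  i-[1+j]≡i-1-j = solve-∀

  i-j-1≡i-[1+j] : ∀ i j → (i - j) - 1ℤ ≡ i - (1ℤ + j)
  i-j-1≡i-[1+j] = solve-∀

  -- binomShift ν d m = binom (d - ν) (m - ν), read as 0 when m < ν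
  binomShift : ℕ → ℤ → ℕ → ℤ
  binomShift zero    d m       = binom d m
  binomShift (suc ν) d zero    = 0ℤ
  binomShift (suc ν) d (suc m) = binomShift ν (d - 1ℤ) m

  binomShift-difference : ∀ ν d m → binomShift ν d m - binomShift ν (d - 1ℤ) m ≡ binomShift (suc ν) d m
  binomShift-difference zero d zero = cong₂ _-_ (binom-0 d) (binom-0 (d - 1ℤ))
  binomShift-difference zero d (suc m) = begin
    binom d (suc m) - binom (d - 1ℤ) (suc m)
      ≡⟨ cong (λ c → binom c (suc m) - binom (d - 1ℤ) (suc m)) (1+[d-1]≡d d) ⟨
    binom (1ℤ + (d - 1ℤ)) (suc m) - binom (d - 1ℤ) (suc m)
      ≡⟨ cong (_- binom (d - 1ℤ) (suc m)) (binom-pascal (d - 1ℤ) m) ⟩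
    (binom (d - 1ℤ) (suc m) + binom (d - 1ℤ) m) - binom (d - 1ℤ) (suc m)
      ≡⟨ [x+y]-x≡y (binom (d - 1ℤ) (suc m)) (binom (d - 1ℤ) m) ⟩
    binom (d - 1ℤ) m ∎
    where
    1+[d-1]≡d : ∀ d → 1ℤ + (d - 1ℤ) ≡ d
    1+[d-1]≡d = solve-∀
    [x+y]-x≡y : ∀ x y → (x + y) - x ≡ y
    [x+y]-x≡y = solve-∀
  binomShift-difference (suc ν) d zero    = refl
  binomShift-difference (suc ν) d (suc m) = binomShift-difference ν (d - 1ℤ) m

  binomShift-< : ∀ ν d m → m ℕ.< ν → binomShift ν d m ≡ 0ℤ
  binomShift-< (suc ν) d zero    _          = refl
  binomShift-< (suc ν) d (suc m) (ℕ.s≤s m<ν) = binomShift-< ν (d - 1ℤ) m m<ν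

  binomShift-+ : ∀ ν d m → binomShift ν d (ν ℕ.+ m) ≡ binom (d - + ν) m
  binomShift-+ zero    d m = cong (λ c → binom c m) (sym (ℤP.+-identityʳ d))
  binomShift-+ (suc ν) d m = trans (binomShift-+ ν (d - 1ℤ) m) (cong (λ c → binom c m) (sym (i-[1+j]≡i-1-j d (+ ν))))

  +m-+n≡+[m∸n] : ∀ {m n} → n ℕ.≤ m → + m - + n ≡ + (m ℕ.∸ n)
  +m-+n≡+[m∸n] {m} {n} n≤m = trans (ℤP.[+m]-[+n]≡m⊖n m n) (ℤP.⊖-≥ n≤m)

  m≤o⇒n≤o∸m⇒m≤o∸n : ∀ {m n o} → m ≤ o → n ≤ o ∸ m → m ≤ o ∸ n
  m≤o⇒n≤o∸m⇒m≤o∸n {m} {n} {o} m≤o n≤o∸m =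
    ℕP.m+n≤o⇒m≤o∸n m (subst (_≤ o) (ℕP.+-comm n m) (ℕP.m≤o∸n⇒m+n≤o n m≤o n≤o∸m))

  [K∸ν]C[K∸i∸ν]≡[K∸ν]Ci : ∀ {K i ν} → i ≤ K → ν ≤ K ∸ i → (K ∸ ν) C (K ∸ i ∸ ν) ≡ (K ∸ ν) C i
  [K∸ν]C[K∸i∸ν]≡[K∸ν]Ci {K} {i} {ν} i≤K ν≤K∸i = begin
    (K ∸ ν) C (K ∸ i ∸ ν)  ≡⟨ cong ((K ∸ ν) C_) (m∸n∸o≡m∸o∸n K i ν) ⟩
    (K ∸ ν) C (K ∸ ν ∸ i)  ≡⟨ nCk≡nC[n∸k] (m≤o⇒n≤o∸m⇒m≤o∸n i≤K ν≤K∸i) ⟨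
    (K ∸ ν) C i            ∎
    where
    m∸n∸o≡m∸o∸n : ∀ m n o → m ∸ n ∸ o ≡ m ∸ o ∸ n
    m∸n∸o≡m∸o∸n m n o = trans (ℕP.∸-+-assoc m n o) (trans (cong (m ∸_) (ℕP.+-comm n o)) (sym (ℕP.∸-+-assoc m o n)))

  K∸i<ν⇒[K∸ν]Ci≡0 : ∀ {K i ν} → ν ≤ K → K ∸ i < ν → (K ∸ ν) C i ≡ 0
  K∸i<ν⇒[K∸ν]Ci≡0 {K} {i} {ν} ν≤K K∸i<ν =
    k>n⇒nCk≡0 (ℕP.≰⇒> λ i≤K∸ν → ℕP.<⇒≱ K∸i<ν (m≤o⇒n≤o∸m⇒m≤o∸n {ν} {i} ν≤K i≤K∸ν))

  binomShift-reflect : ∀ {K i ν} → ν ≤ K → i ≤ K → binomShift ν (+ K) (K ∸ i) ≡ + ((K ∸ ν) C i)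
  binomShift-reflect {K} {i} {ν} ν≤K i≤K with ν ℕ.≤? K ∸ i
  ... | yes ν≤K∸i = begin
    binomShift ν (+ K) (K ∸ i)                   ≡⟨ cong (binomShift ν (+ K)) (ℕP.m+[n∸m]≡n ν≤K∸i) ⟨
    binomShift ν (+ K) (ν ℕ.+ (K ∸ i ∸ ν))       ≡⟨ binomShift-+ ν (+ K) (K ∸ i ∸ ν) ⟩
    binom (+ K - + ν) (K ∸ i ∸ ν)                ≡⟨ cong (λ c → binom c (K ∸ i ∸ ν)) (+m-+n≡+[m∸n] ν≤K) ⟩
    + ((K ∸ ν) C (K ∸ i ∸ ν))                    ≡⟨ cong +_ ([K∸ν]C[K∸i∸ν]≡[K∸ν]Ci {K} i≤K ν≤K∸i) ⟩
    + ((K ∸ ν) C i)                              ∎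
  ... | no ν≰K∸i = begin
    binomShift ν (+ K) (K ∸ i)                   ≡⟨ binomShift-< ν (+ K) (K ∸ i) (ℕP.≰⇒> ν≰K∸i) ⟩
    0ℤ                                           ≡⟨ cong +_ (K∸i<ν⇒[K∸ν]Ci≡0 {K} {i} ν≤K (ℕP.≰⇒> ν≰K∸i)) ⟨
    + ((K ∸ ν) C i)                              ∎

  i-[n∸m]≡[i-n]+m : ∀ i {m n} → m ≤ n → i - + (n ∸ m) ≡ (i - + n) + + m
  i-[n∸m]≡[i-n]+m i {m} {n} m≤n = begin
    i - + (n ∸ m)        ≡⟨ cong (λ z → i - z) (+m-+n≡+[m∸n] m≤n) ⟨
    i - (+ n - + m)      ≡⟨ i-[n-m]≡[i-n]+m i (+ n) (+ m) ⟩
    (i - + n) + + m      ∎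
    where
    i-[n-m]≡[i-n]+m : ∀ i n m → i - (n - m) ≡ (i - n) + m
    i-[n-m]≡[i-n]+m = solve-∀

open Binomial

module SeriesProperties {c ℓ} (R : CommutativeRing c ℓ) where
  open CommutativeRing R hiding (zero)
  open Series R
  open import Algebra.Properties.Ring ring using (-1*x≈-x; -‿distribˡ-*; -‿distribʳ-*; -‿involutive; -‿+-comm; -0#≈0#)
  open import Algebra.Properties.CommutativeSemigroup +-commutativeSemigroup using ()
    renaming (interchange to +-interchange; x∙yz≈y∙xz to x+[y+z]≈y+[x+z]; x∙yz≈xz∙y to x+[y+z]≈[x+z]+y)
  open import Algebra.Properties.Semiring.Mult semiring using (×-homo-+; ×1-homo-*) renaming (_×_ to _×ℕ_)
  open import Algebra.Properties.CommutativeSemigroup *-commutativeSemigroup using (x∙yz≈yx∙z; x∙yz≈xz∙y)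
  open import Algebra.Properties.AbelianGroup +-abelianGroup using () renaming (xyx⁻¹≈y to x+y-x≈y)
  open import Relation.Binary.Reasoning.Setoid setoid

  ιℕ≈×1# : ∀ n → ιℕ n ≈ n ×ℕ 1#
  ιℕ≈×1# zero    = refl
  ιℕ≈×1# (suc n) = +-congˡ (ιℕ≈×1# n)

  ιℕ-1 : ιℕ 1 ≈ 1#
  ιℕ-1 = +-identityʳ 1#

  ιℕ-+ : ∀ m n → ιℕ (m ℕ.+ n) ≈ ιℕ m + ιℕ n
  ιℕ-+ m n = begin
    ιℕ (m ℕ.+ n)            ≈⟨ ιℕ≈×1# (m ℕ.+ n) ⟩
    (m ℕ.+ n) ×ℕ 1#         ≈⟨ ×-homo-+ 1# m n ⟩
    m ×ℕ 1# + n ×ℕ 1#       ≈⟨ +-cong (ιℕ≈×1# m) (ιℕ≈×1# n) ⟨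
    ιℕ m + ιℕ n             ∎

  ιℕ-* : ∀ m n → ιℕ (m ℕ.* n) ≈ ιℕ m * ιℕ n
  ιℕ-* m n = begin
    ιℕ (m ℕ.* n)            ≈⟨ ιℕ≈×1# (m ℕ.* n) ⟩
    (m ℕ.* n) ×ℕ 1#         ≈⟨ ×1-homo-* m n ⟩
    (m ×ℕ 1#) * (n ×ℕ 1#)   ≈⟨ *-cong (ιℕ≈×1# m) (ιℕ≈×1# n) ⟨
    ιℕ m * ιℕ n             ∎

  ιℤ-neg : ∀ z → ιℤ (ℤ.- z) ≈ - ιℤ z
  ιℤ-neg (+ zero)  = sym -0#≈0#
  ιℤ-neg (+ suc n) = refl
  ιℤ-neg -[1+ n ]  = sym (-‿involutive _)

  ιℤ-⊖ : ∀ m n → ιℤ (m ℤ.⊖ n) ≈ ιℕ m - ιℕ n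
  ιℤ-⊖ m       zero    = begin
    ιℤ (m ℤ.⊖ 0)  ≡⟨ ≡.cong ιℤ (ℤP.⊖-≥ {m} z≤n) ⟩
    ιℕ m          ≈⟨ +-identityʳ (ιℕ m) ⟨
    ιℕ m + 0#     ≈⟨ +-congˡ -0#≈0# ⟨
    ιℕ m - 0#     ∎
  ιℤ-⊖ zero    (suc n) = sym (+-identityˡ _)
  ιℤ-⊖ (suc m) (suc n) = begin
    ιℤ (suc m ℤ.⊖ suc n)       ≡⟨ ≡.cong ιℤ (ℤP.[1+m]⊖[1+n]≡m⊖n m n) ⟩
    ιℤ (m ℤ.⊖ n)               ≈⟨ ιℤ-⊖ m n ⟩
    ιℕ m - ιℕ n                ≈⟨ +-congʳ (x+y-x≈y 1# (ιℕ m)) ⟨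
    1# + ιℕ m - 1# - ιℕ n      ≈⟨ +-assoc _ _ _ ⟩
    1# + ιℕ m + (- 1# - ιℕ n)  ≈⟨ +-congˡ (-‿+-comm 1# (ιℕ n)) ⟩
    (1# + ιℕ m) - (1# + ιℕ n)  ∎

  ιℤ-+ : ∀ x y → ιℤ (x ℤ.+ y) ≈ ιℤ x + ιℤ y
  ιℤ-+ (+ m)    (+ n)    = ιℕ-+ m n
  ιℤ-+ (+ m)    -[1+ n ] = ιℤ-⊖ m (suc n)
  ιℤ-+ -[1+ m ] (+ n)    = trans (ιℤ-⊖ n (suc m)) (+-comm _ _)
  ιℤ-+ -[1+ m ] -[1+ n ] = begin
    - (1# + (1# + ιℕ (m ℕ.+ n)))    ≈⟨ -‿cong (+-congˡ (+-congˡ (ιℕ-+ m n))) ⟩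
    - (1# + (1# + (ιℕ m + ιℕ n)))   ≈⟨ -‿cong (+-congˡ (x+[y+z]≈y+[x+z] 1# (ιℕ m) (ιℕ n))) ⟩
    - (1# + (ιℕ m + (1# + ιℕ n)))   ≈⟨ -‿cong (+-assoc 1# (ιℕ m) (1# + ιℕ n)) ⟨
    - (1# + ιℕ m + (1# + ιℕ n))     ≈⟨ -‿+-comm (1# + ιℕ m) (1# + ιℕ n) ⟨
    - (1# + ιℕ m) + - (1# + ιℕ n)   ∎

  ιℤ-+* : ∀ m y → ιℤ (+ m ℤ.* y) ≈ ιℕ m * ιℤ y
  ιℤ-+* m (+ n) = trans (reflexive (≡.cong ιℤ (≡.sym (ℤP.pos-* m n)))) (ιℕ-* m n)
  ιℤ-+* m -[1+ n ] = begin
    ιℤ (+ m ℤ.* -[1+ n ])      ≡⟨ ≡.cong ιℤ (ℤP.neg-distribʳ-* (+ m) (+ suc n)) ⟨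
    ιℤ (ℤ.- (+ m ℤ.* + suc n)) ≈⟨ ιℤ-neg (+ m ℤ.* + suc n) ⟩
    - ιℤ (+ m ℤ.* + suc n)     ≈⟨ -‿cong (ιℤ-+* m (+ suc n)) ⟩
    - (ιℕ m * ιℕ (suc n))      ≈⟨ -‿distribʳ-* _ _ ⟩
    ιℕ m * - ιℕ (suc n)        ∎

  ιℤ-* : ∀ x y → ιℤ (x ℤ.* y) ≈ ιℤ x * ιℤ y
  ιℤ-* (+ m)    y = ιℤ-+* m y
  ιℤ-* -[1+ m ] y = begin
    ιℤ (-[1+ m ] ℤ.* y)        ≡⟨ ≡.cong ιℤ (ℤP.neg-distribˡ-* (+ suc m) y) ⟨
    ιℤ (ℤ.- (+ suc m ℤ.* y))   ≈⟨ ιℤ-neg (+ suc m ℤ.* y) ⟩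
    - ιℤ (+ suc m ℤ.* y)       ≈⟨ -‿cong (ιℤ-+* (suc m) y) ⟩
    - (ιℕ (suc m) * ιℤ y)      ≈⟨ -‿distribˡ-* _ _ ⟩
    - ιℕ (suc m) * ιℤ y        ∎

  x*nCk*y≈0 : ∀ x y {n k} → n < k → x * ιℕ (n C k) * y ≈ 0#
  x*nCk*y≈0 x y n<k = trans (*-congʳ (trans (*-congˡ (reflexive (≡.cong ιℕ (k>n⇒nCk≡0 n<k)))) (zeroʳ x))) (zeroˡ y)

  Σ<-cong : ∀ n {f g : ℕ → Carrier} → (∀ i → i < n → f i ≈ g i) → Σ< n f ≈ Σ< n g
  Σ<-cong zero    f≈g = refl
  Σ<-cong (suc n) f≈g = +-cong (Σ<-cong n (λ i i<n → f≈g i (ℕP.m<n⇒m<1+n i<n))) (f≈g n ℕP.≤-refl)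

  Σ<-≈0 : ∀ n {f : ℕ → Carrier} → (∀ i → i < n → f i ≈ 0#) → Σ< n f ≈ 0#
  Σ<-≈0 zero    f≈0 = refl
  Σ<-≈0 (suc n) f≈0 = trans (+-cong (Σ<-≈0 n (λ i i<n → f≈0 i (ℕP.m<n⇒m<1+n i<n))) (f≈0 n ℕP.≤-refl)) (+-identityˡ 0#)

  Σ<-+ : ∀ n (f g : ℕ → Carrier) → Σ< n (λ i → f i + g i) ≈ Σ< n f + Σ< n g
  Σ<-+ zero    f g = sym (+-identityˡ 0#)
  Σ<-+ (suc n) f g = trans (+-congʳ (Σ<-+ n f g)) (+-interchange _ _ _ _)

  *-distribˡ-Σ< : ∀ n x (f : ℕ → Carrier) → x * Σ< n f ≈ Σ< n (λ i → x * f i)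
  *-distribˡ-Σ< zero    x f = zeroʳ x
  *-distribˡ-Σ< (suc n) x f = trans (distribˡ _ _ _) (+-congʳ (*-distribˡ-Σ< n x f))

  *-distribʳ-Σ< : ∀ n x (f : ℕ → Carrier) → Σ< n f * x ≈ Σ< n (λ i → f i * x)
  *-distribʳ-Σ< n x f = trans (*-comm _ _) (trans (*-distribˡ-Σ< n x f) (Σ<-cong n (λ i _ → *-comm x (f i))))

  -‿distrib-Σ< : ∀ n (f : ℕ → Carrier) → - Σ< n f ≈ Σ< n (λ i → - f i)
  -‿distrib-Σ< zero    f = -0#≈0#
  -‿distrib-Σ< (suc n) f = trans (sym (-‿+-comm _ _)) (+-congʳ (-‿distrib-Σ< n f))

  Σ<-suc : ∀ n (f : ℕ → Carrier) → Σ< (suc n) f ≈ f 0 + Σ< n (λ i → f (suc i))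
  Σ<-suc zero    f = trans (+-identityˡ _) (sym (+-identityʳ _))
  Σ<-suc (suc n) f = trans (+-congʳ (Σ<-suc n f)) (+-assoc _ _ _)

  Σ<-split : ∀ a b (f : ℕ → Carrier) → Σ< (a ℕ.+ b) f ≈ Σ< a f + Σ< b (λ t → f (a ℕ.+ t))
  Σ<-split a zero    f = trans (reflexive (≡.cong (λ k → Σ< k f) (ℕP.+-identityʳ a))) (sym (+-identityʳ _))
  Σ<-split a (suc b) f rewrite ℕP.+-suc a b = trans (+-congʳ (Σ<-split a b f)) (+-assoc _ _ _)

  Σ<-swap : ∀ a b (f : ℕ → ℕ → Carrier) → Σ< a (λ i → Σ< b (f i)) ≈ Σ< b (λ j → Σ< a (λ i → f i j))
  Σ<-swap zero    b f = sym (Σ<-≈0 b (λ _ _ → refl))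
  Σ<-swap (suc a) b f = trans (+-congʳ (Σ<-swap a b f)) (sym (Σ<-+ b _ _))

  Σ<-reverse : ∀ m (f : ℕ → Carrier) → Σ< m f ≈ Σ< m (λ i → f (m ℕ.∸ suc i))
  Σ<-reverse zero    f = refl
  Σ<-reverse (suc m) f = begin
    Σ< m f + f m                                  ≈⟨ +-comm _ _ ⟩
    f m + Σ< m f                                  ≈⟨ +-congˡ (Σ<-reverse m f) ⟩
    f m + Σ< m (λ i → f (m ℕ.∸ suc i))            ≈⟨ Σ<-suc m (λ i → f (m ℕ.∸ i)) ⟨
    Σ< (suc m) (λ i → f (suc m ℕ.∸ suc i))        ∎

  vandermonde : ∀ μ d i → Σ< (suc i) (λ j → ιℕ (μ C j) * ιℤ (binom d (i ℕ.∸ j))) ≈ ιℤ (binom (d ℤ.+ + μ) i)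
  vandermonde zero d i = begin
    Σ< (suc i) (λ j → ιℕ (0 C j) * ιℤ (binom d (i ℕ.∸ j)))
      ≈⟨ Σ<-suc i _ ⟩
    ιℕ 1 * ιℤ (binom d i) + Σ< i (λ j → 0# * ιℤ (binom d (i ℕ.∸ suc j)))
      ≈⟨ +-cong (trans (*-congʳ ιℕ-1) (*-identityˡ _)) (Σ<-≈0 i (λ _ _ → zeroˡ _)) ⟩
    ιℤ (binom d i) + 0#
      ≈⟨ +-identityʳ _ ⟩
    ιℤ (binom d i)
      ≡⟨ ≡.cong (λ c → ιℤ (binom c i)) (ℤP.+-identityʳ d) ⟨
    ιℤ (binom (d ℤ.+ + 0) i) ∎
  vandermonde (suc μ) d zero = begin
    0# + ιℕ 1 * ιℤ (binom d 0)     ≈⟨ +-identityˡ _ ⟩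
    ιℕ 1 * ιℤ (binom d 0)          ≡⟨ ≡.cong (λ b → ιℕ 1 * ιℤ b) (binom-0 d) ⟩
    ιℕ 1 * ιℕ 1                    ≈⟨ trans (*-congˡ ιℕ-1) (*-identityʳ _) ⟩
    ιℕ 1                           ≡⟨ ≡.cong ιℤ (binom-0 (d ℤ.+ + suc μ)) ⟨
    ιℤ (binom (d ℤ.+ + suc μ) 0)   ∎
  vandermonde (suc μ) d (suc i) = begin
    Σ< (suc (suc i)) (λ j → ιℕ (suc μ C j) * β (suc i ℕ.∸ j))
      ≈⟨ Σ<-suc (suc i) _ ⟩
    β₀ + Σ< (suc i) (λ j → ιℕ (suc μ C suc j) * β (i ℕ.∸ j))
      ≈⟨ +-congˡ (Σ<-cong (suc i) (λ j _ → pascal j)) ⟩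
    β₀ + Σ< (suc i) (λ j → ιℕ (μ C j) * β (i ℕ.∸ j) + ιℕ (μ C suc j) * β (i ℕ.∸ j))
      ≈⟨ +-congˡ (Σ<-+ (suc i) _ _) ⟩
    β₀ + (S + S′)
      ≈⟨ x+[y+z]≈[x+z]+y β₀ S S′ ⟩
    (β₀ + S′) + S
      ≈⟨ +-congʳ (Σ<-suc (suc i) (λ j → ιℕ (μ C j) * β (suc i ℕ.∸ j))) ⟨
    Σ< (suc (suc i)) (λ j → ιℕ (μ C j) * β (suc i ℕ.∸ j)) + S
      ≈⟨ +-cong (vandermonde μ d (suc i)) (vandermonde μ d i) ⟩
    ιℤ (binom (d ℤ.+ + μ) (suc i)) + ιℤ (binom (d ℤ.+ + μ) i)
      ≈⟨ ιℤ-+ (binom (d ℤ.+ + μ) (suc i)) (binom (d ℤ.+ + μ) i) ⟨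
    ιℤ (binom (d ℤ.+ + μ) (suc i) ℤ.+ binom (d ℤ.+ + μ) i)
      ≡⟨ ≡.cong ιℤ (binom-pascal (d ℤ.+ + μ) i) ⟨
    ιℤ (binom (1ℤ ℤ.+ (d ℤ.+ + μ)) (suc i))
      ≡⟨ ≡.cong (λ c → ιℤ (binom c (suc i))) (ℤ+.x∙yz≈y∙xz 1ℤ d (+ μ)) ⟩
    ιℤ (binom (d ℤ.+ + suc μ) (suc i)) ∎
    where
    β : ℕ → Carrier
    β k = ιℤ (binom d k)
    β₀ S S′ : Carrier
    β₀ = ιℕ 1 * β (suc i)
    S  = Σ< (suc i) (λ j → ιℕ (μ C j) * β (i ℕ.∸ j))
    S′ = Σ< (suc i) (λ j → ιℕ (μ C suc j) * β (i ℕ.∸ j))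
    pascal : ∀ j → ιℕ (suc μ C suc j) * β (i ℕ.∸ j) ≈ ιℕ (μ C j) * β (i ℕ.∸ j) + ιℕ (μ C suc j) * β (i ℕ.∸ j)
    pascal j = begin
      ιℕ (suc μ C suc j) * β (i ℕ.∸ j)
        ≡⟨ ≡.cong (λ m → ιℕ m * β (i ℕ.∸ j)) (nCk+nC[k+1]≡[n+1]C[k+1] μ j) ⟨
      ιℕ (μ C j ℕ.+ μ C suc j) * β (i ℕ.∸ j)
        ≈⟨ *-congʳ (ιℕ-+ (μ C j) (μ C suc j)) ⟩
      (ιℕ (μ C j) + ιℕ (μ C suc j)) * β (i ℕ.∸ j)
        ≈⟨ distribʳ _ _ _ ⟩
      ιℕ (μ C j) * β (i ℕ.∸ j) + ιℕ (μ C suc j) * β (i ℕ.∸ j) ∎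

  powS-oneMinusX : ∀ ν j → powS oneMinusX ν j ≈ sgn j * ιℕ (ν C j)
  powS-oneMinusX zero    zero    = sym (trans (*-identityˡ _) ιℕ-1)
  powS-oneMinusX zero    (suc j) = sym (zeroʳ _)
  powS-oneMinusX (suc ν) zero    = trans (+-identityˡ _) (trans (*-identityˡ _) (powS-oneMinusX ν zero))
  powS-oneMinusX (suc ν) (suc j) = begin
    Σ< (suc (suc j)) (λ t → oneMinusX t * p (suc j ℕ.∸ t))
      ≈⟨ Σ<-suc (suc j) _ ⟩
    1# * p (suc j) + Σ< (suc j) (λ t → oneMinusX (suc t) * p (j ℕ.∸ t))
      ≈⟨ +-cong (*-identityˡ _) (Σ<-suc j _) ⟩
    p (suc j) + (- 1# * p j + Σ< j (λ t → 0# * p (j ℕ.∸ suc t)))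
      ≈⟨ +-congˡ (+-cong (-1*x≈-x (p j)) (Σ<-≈0 j (λ _ _ → zeroˡ _))) ⟩
    p (suc j) + (- p j + 0#)
      ≈⟨ +-congˡ (+-identityʳ _) ⟩
    p (suc j) + - p j
      ≈⟨ +-cong (powS-oneMinusX ν (suc j)) (-‿cong (powS-oneMinusX ν j)) ⟩
    sgn (suc j) * ιℕ (ν C suc j) + - (sgn j * ιℕ (ν C j))
      ≈⟨ +-comm _ _ ⟩
    - (sgn j * ιℕ (ν C j)) + sgn (suc j) * ιℕ (ν C suc j)
      ≈⟨ +-congʳ (-‿distribˡ-* _ _) ⟩
    sgn (suc j) * ιℕ (ν C j) + sgn (suc j) * ιℕ (ν C suc j)
      ≈⟨ distribˡ _ _ _ ⟨
    sgn (suc j) * (ιℕ (ν C j) + ιℕ (ν C suc j))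
      ≈⟨ *-congˡ (ιℕ-+ (ν C j) (ν C suc j)) ⟨
    sgn (suc j) * ιℕ (ν C j ℕ.+ ν C suc j)
      ≡⟨ ≡.cong (λ m → sgn (suc j) * ιℕ m) (nCk+nC[k+1]≡[n+1]C[k+1] ν j) ⟩
    sgn (suc j) * ιℕ (suc ν C suc j) ∎
    where
    p : ℕ → Carrier
    p = powS oneMinusX ν

  alternatingBinom : ℕ → ℤ → ℕ → Carrier
  alternatingBinom ν d m = Σ< (suc ν) (λ j → sgn j * ιℕ (ν C j) * ιℤ (binom (d ℤ.- + j) m))

  alternatingBinom-suc : ∀ ν d m →
    alternatingBinom (suc ν) d m ≈ alternatingBinom ν d m - alternatingBinom ν (d ℤ.- 1ℤ) m
  alternatingBinom-suc ν d m = begin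
    Σ< (suc (suc ν)) (λ j → sgn j * ιℕ (suc ν C j) * β d j)
      ≈⟨ Σ<-suc (suc ν) _ ⟩
    t₀ + Σ< (suc ν) (λ j → sgn (suc j) * ιℕ (suc ν C suc j) * β d (suc j))
      ≈⟨ +-congˡ (Σ<-cong (suc ν) (λ j _ → pascal j)) ⟩
    t₀ + Σ< (suc ν) (λ j → - u j + t j)
      ≈⟨ +-congˡ (trans (Σ<-+ (suc ν) _ _) (+-comm _ _)) ⟩
    t₀ + (Σ< (suc ν) t + Σ< (suc ν) (λ j → - u j))
      ≈⟨ +-assoc _ _ _ ⟨
    (t₀ + Σ< (suc ν) t) + Σ< (suc ν) (λ j → - u j)
      ≈⟨ +-cong (Σ<-suc (suc ν) _) (-‿distrib-Σ< (suc ν) u) ⟨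
    Σ< (suc (suc ν)) (λ j → sgn j * ιℕ (ν C j) * β d j) - alternatingBinom ν (d ℤ.- 1ℤ) m
      ≈⟨ +-congʳ (+-congˡ (x*nCk*y≈0 _ _ (ℕP.n<1+n ν))) ⟩
    alternatingBinom ν d m + 0# - alternatingBinom ν (d ℤ.- 1ℤ) m
      ≈⟨ +-congʳ (+-identityʳ _) ⟩
    alternatingBinom ν d m - alternatingBinom ν (d ℤ.- 1ℤ) m ∎
    where
    β : ℤ → ℕ → Carrier
    β e j = ιℤ (binom (e ℤ.- + j) m)
    t₀ : Carrier
    t₀ = sgn 0 * ιℕ (ν C 0) * β d 0
    t u : ℕ → Carrier
    t j = sgn (suc j) * ιℕ (ν C suc j) * β d (suc j)
    u j = sgn j * ιℕ (ν C j) * β (d ℤ.- 1ℤ) j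
    pascal : ∀ j → sgn (suc j) * ιℕ (suc ν C suc j) * β d (suc j) ≈ - u j + t j
    pascal j = begin
      sgn (suc j) * ιℕ (suc ν C suc j) * β d (suc j)
        ≡⟨ ≡.cong (λ k → sgn (suc j) * ιℕ k * β d (suc j)) (nCk+nC[k+1]≡[n+1]C[k+1] ν j) ⟨
      sgn (suc j) * ιℕ (ν C j ℕ.+ ν C suc j) * β d (suc j)
        ≈⟨ *-congʳ (trans (*-congˡ (ιℕ-+ (ν C j) (ν C suc j))) (distribˡ _ _ _)) ⟩
      (sgn (suc j) * ιℕ (ν C j) + sgn (suc j) * ιℕ (ν C suc j)) * β d (suc j)
        ≈⟨ distribʳ _ _ _ ⟩
      - sgn j * ιℕ (ν C j) * β d (suc j) + t j
        ≈⟨ +-congʳ (*-cong (sym (-‿distribˡ-* _ _)) (reflexive (≡.cong (λ c → ιℤ (binom c m)) (i-[1+j]≡i-1-j d (+ j))))) ⟩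
      - (sgn j * ιℕ (ν C j)) * β (d ℤ.- 1ℤ) j + t j
        ≈⟨ +-congʳ (sym (-‿distribˡ-* _ _)) ⟩
      - u j + t j ∎

  alternatingBinom≈binomShift : ∀ ν d m → alternatingBinom ν d m ≈ ιℤ (binomShift ν d m)
  alternatingBinom≈binomShift zero d m = begin
    0# + 1# * ιℕ 1 * ιℤ (binom (d ℤ.+ 0ℤ) m)   ≈⟨ +-identityˡ _ ⟩
    1# * ιℕ 1 * ιℤ (binom (d ℤ.+ 0ℤ) m)        ≈⟨ *-congʳ (trans (*-identityˡ _) ιℕ-1) ⟩
    1# * ιℤ (binom (d ℤ.+ 0ℤ) m)               ≈⟨ *-identityˡ _ ⟩
    ιℤ (binom (d ℤ.+ 0ℤ) m)                    ≡⟨ ≡.cong (λ c → ιℤ (binom c m)) (ℤP.+-identityʳ d) ⟩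
    ιℤ (binom d m)                             ∎
  alternatingBinom≈binomShift (suc ν) d m = begin
    alternatingBinom (suc ν) d m
      ≈⟨ alternatingBinom-suc ν d m ⟩
    alternatingBinom ν d m - alternatingBinom ν (d ℤ.- 1ℤ) m
      ≈⟨ +-cong (alternatingBinom≈binomShift ν d m) (-‿cong (alternatingBinom≈binomShift ν (d ℤ.- 1ℤ) m)) ⟩
    ιℤ (binomShift ν d m) - ιℤ (binomShift ν (d ℤ.- 1ℤ) m)
      ≈⟨ +-congˡ (ιℤ-neg (binomShift ν (d ℤ.- 1ℤ) m)) ⟨
    ιℤ (binomShift ν d m) + ιℤ (ℤ.- binomShift ν (d ℤ.- 1ℤ) m)
      ≈⟨ ιℤ-+ (binomShift ν d m) (ℤ.- binomShift ν (d ℤ.- 1ℤ) m) ⟨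
    ιℤ (binomShift ν d m ℤ.- binomShift ν (d ℤ.- 1ℤ) m)
      ≡⟨ ≡.cong ιℤ (binomShift-difference ν d m) ⟩
    ιℤ (binomShift (suc ν) d m) ∎

  Σ<-extend : ∀ a b (f : ℕ → Carrier) → (∀ i → a ≤ i → f i ≈ 0#) → Σ< (a ℕ.+ b) f ≈ Σ< a f
  Σ<-extend a b f f≈0 = begin
    Σ< (a ℕ.+ b) f                       ≈⟨ Σ<-split a b f ⟩
    Σ< a f + Σ< b (λ t → f (a ℕ.+ t))    ≈⟨ +-congˡ (Σ<-≈0 b (λ t _ → f≈0 (a ℕ.+ t) (ℕP.m≤m+n a t))) ⟩
    Σ< a f + 0#                          ≈⟨ +-identityʳ _ ⟩
    Σ< a f                               ∎

  -- Σ_j [x^j](1 - x)^ν · (1 + y)^(K - j) = y^ν (1 + y)^(K - ν); compare the coefficients of y^(K - i).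
  Σ<-[1-x]^ν*C : ∀ K n ν i → ν ≤ n → n ≤ K → i ≤ K →
    Σ< (suc n) (λ j → powS oneMinusX ν j * ιℕ ((K ℕ.∸ j) C (K ℕ.∸ i))) ≈ ιℕ ((K ℕ.∸ ν) C i)
  Σ<-[1-x]^ν*C K n ν i ν≤n n≤K i≤K = begin
    Σ< (suc n) (λ j → powS oneMinusX ν j * ιℕ ((K ℕ.∸ j) C m))
      ≈⟨ Σ<-cong (suc n) (λ j j≤n → *-cong (powS-oneMinusX ν j) (reflexive (≡.cong (λ c → ιℤ (binom c m))
           (≡.sym (+m-+n≡+[m∸n] (ℕP.≤-trans (ℕP.≤-pred j≤n) n≤K)))))) ⟩
    Σ< (suc n) f
      ≡⟨ ≡.cong (λ k → Σ< k f) (ℕP.m+[n∸m]≡n (s≤s ν≤n)) ⟨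
    Σ< (suc ν ℕ.+ (suc n ℕ.∸ suc ν)) f
      ≈⟨ Σ<-extend (suc ν) (suc n ℕ.∸ suc ν) f (λ j ν<j → x*nCk*y≈0 _ _ ν<j) ⟩
    alternatingBinom ν (+ K) m
      ≈⟨ alternatingBinom≈binomShift ν (+ K) m ⟩
    ιℤ (binomShift ν (+ K) m)
      ≡⟨ ≡.cong ιℤ (binomShift-reflect (ℕP.≤-trans ν≤n n≤K) i≤K) ⟩
    ιℕ ((K ℕ.∸ ν) C i) ∎
    where
    m : ℕ
    m = K ℕ.∸ i
    f : ℕ → Carrier
    f j = sgn j * ιℕ (ν C j) * ιℤ (binom (+ K ℤ.- + j) m)

  derivTermN : ℕ → Carrier × ℤ → Carrier × ℤ
  derivTermN zero    t = t
  derivTermN (suc i) t = ιℤ (proj₂ (derivTermN i t)) * proj₁ (derivTermN i t) , proj₂ (derivTermN i t) ℤ.- 1ℤ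

  derivN-[] : ∀ i → derivN i [] ≡ []
  derivN-[] zero    = ≡.refl
  derivN-[] (suc i) = ≡.cong deriv (derivN-[] i)

  derivN-∷ : ∀ i t L → derivN i (t ∷ L) ≡ derivTermN i t ∷ derivN i L
  derivN-∷ zero    t L = ≡.refl
  derivN-∷ (suc i) t L = ≡.cong deriv (derivN-∷ i t L)

  derivTermN-exponent : ∀ i a e → proj₂ (derivTermN i (a , e)) ≡ e ℤ.- + i
  derivTermN-exponent zero    a e = ≡.sym (ℤP.+-identityʳ e)
  derivTermN-exponent (suc i) a e = ≡.trans (≡.cong (ℤ._- 1ℤ) (derivTermN-exponent i a e)) (i-j-1≡i-[1+j] e (+ i))

  derivTermN-coefficient : ∀ i a e → proj₁ (derivTermN i (a , e)) ≈ ιℤ (fallingℤ e i) * a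
  derivTermN-coefficient zero    a e = sym (trans (*-congʳ ιℕ-1) (*-identityˡ a))
  derivTermN-coefficient (suc i) a e = begin
    ιℤ (proj₂ (derivTermN i (a , e))) * proj₁ (derivTermN i (a , e))
      ≈⟨ *-cong (reflexive (≡.cong ιℤ (derivTermN-exponent i a e))) (derivTermN-coefficient i a e) ⟩
    ιℤ (e ℤ.- + i) * (ιℤ (fallingℤ e i) * a)
      ≈⟨ x∙yz≈yx∙z _ _ _ ⟩
    ιℤ (fallingℤ e i) * ιℤ (e ℤ.- + i) * a
      ≈⟨ *-congʳ (ιℤ-* (fallingℤ e i) (e ℤ.- + i)) ⟨
    ιℤ (fallingℤ e i ℤ.* (e ℤ.- + i)) * a ∎

  at1+x-taylor : ∀ i L → ιℕ (i !) * at1+x L i ≈ evalAt1 (derivN i L)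
  at1+x-taylor i [] = trans (zeroʳ _) (reflexive (≡.cong evalAt1 (≡.sym (derivN-[] i))))
  at1+x-taylor i ((a , e) ∷ L) = begin
    ιℕ (i !) * (a * ιℤ (gbinom e i) + at1+x L i)
      ≈⟨ distribˡ _ _ _ ⟩
    ιℕ (i !) * (a * ιℤ (gbinom e i)) + ιℕ (i !) * at1+x L i
      ≈⟨ +-cong leading (at1+x-taylor i L) ⟩
    proj₁ (derivTermN i (a , e)) + evalAt1 (derivN i L)
      ≡⟨ ≡.cong evalAt1 (derivN-∷ i (a , e) L) ⟨
    evalAt1 (derivN i ((a , e) ∷ L)) ∎
    where
    leading : ιℕ (i !) * (a * ιℤ (gbinom e i)) ≈ proj₁ (derivTermN i (a , e))
    leading = begin
      ιℕ (i !) * (a * ιℤ (gbinom e i))     ≈⟨ x∙yz≈xz∙y _ _ _ ⟩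
      ιℕ (i !) * ιℤ (gbinom e i) * a       ≡⟨ ≡.cong (λ b → ιℕ (i !) * ιℤ b * a) (gbinom≡binom e i) ⟩
      ιℕ (i !) * ιℤ (binom e i) * a        ≈⟨ *-congʳ (ιℤ-+* (i !) (binom e i)) ⟨
      ιℤ (+ (i !) ℤ.* binom e i) * a       ≡⟨ ≡.cong (λ z → ιℤ z * a) (fallingℤ≡!*binom i e) ⟨
      ιℤ (fallingℤ e i) * a                ≈⟨ derivTermN-coefficient i a e ⟨
      proj₁ (derivTermN i (a , e))         ∎

  at1+x-map-applyUpTo : ∀ (t : ℕ → Carrier × ℤ) (s : ℕ → ℕ) m i →
    at1+x (map t (applyUpTo s m)) i ≈ Σ< m (λ ν → proj₁ (t (s ν)) * ιℤ (gbinom (proj₂ (t (s ν))) i))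
  at1+x-map-applyUpTo t s zero    i = refl
  at1+x-map-applyUpTo t s (suc m) i =
    trans (+-congˡ (at1+x-map-applyUpTo t (λ ν → s (suc ν)) m i)) (sym (Σ<-suc m _))

  sgn-odd : ∀ n → n ℕ.% 2 ≡ 1 → sgn n ≈ - 1#
  sgn-odd 1             _   = refl
  sgn-odd (suc (suc n)) odd = trans (-‿involutive _) (sgn-odd n odd)

  x≈-x⇒x≈0 : TorsionFree → ∀ {x} → x ≈ - x → x ≈ 0#
  x≈-x⇒x≈0 torsionFree {x} x≈-x = torsionFree 1 x (begin
    (1# + (1# + 0#)) * x  ≈⟨ *-congʳ (+-congˡ (+-identityʳ 1#)) ⟩
    (1# + 1#) * x         ≈⟨ distribʳ _ _ _ ⟩
    1# * x + 1# * x       ≈⟨ +-cong (*-identityˡ x) (*-identityˡ x) ⟩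
    x + x                 ≈⟨ +-congˡ x≈-x ⟩
    x - x                 ≈⟨ -‿inverseʳ x ⟩
    0#                    ∎)

module PaperProperties {c ℓ} (R : CommutativeRing c ℓ) (α : ℕ → CommutativeRing.Carrier R) where
  open CommutativeRing R hiding (zero)
  open Series R
  open Paper α
  open SeriesProperties R
  open import Algebra.Properties.Ring ring using (-1*x≈-x)
  open import Algebra.Properties.CommutativeSemigroup *-commutativeSemigroup using (xy∙z≈xz∙y)
  open import Relation.Binary.Reasoning.Setoid setoid

  Cpoly-≤ : ∀ {n j} → j ≤ n → Cpoly n j ≈ a n j
  Cpoly-≤ j≤n = reflexive (if-≤ᵇ-of-≤ j≤n)

  Cpoly-> : ∀ {n j} → n < j → Cpoly n j ≈ 0#
  Cpoly-> n<j = reflexive (if-≤ᵇ-of-> n<j)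

  Cpoly≈Σ : ∀ n j → Cpoly n j ≈ Σ< (suc n) (λ μ → ιℕ (n C μ) * ιℕ (μ C j) * α μ)
  Cpoly≈Σ n j with j ℕ.≤? n
  ... | yes j≤n = begin
    Cpoly n j                                          ≈⟨ Cpoly-≤ j≤n ⟩
    a n j                                              ≈⟨ +-identityˡ _ ⟨
    0# + a n j                                         ≈⟨ +-congʳ (Σ<-≈0 j (λ μ μ<j → x*nCk*y≈0 _ _ μ<j)) ⟨
    Σ< j f + Σ< (suc n ℕ.∸ j) (λ t → f (j ℕ.+ t))      ≈⟨ Σ<-split j (suc n ℕ.∸ j) f ⟨
    Σ< (j ℕ.+ (suc n ℕ.∸ j)) f                         ≡⟨ ≡.cong (λ k → Σ< k f) (ℕP.m+[n∸m]≡n (ℕP.m≤n⇒m≤1+n j≤n)) ⟩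
    Σ< (suc n) f                                       ∎
    where
    f : ℕ → Carrier
    f μ = ιℕ (n C μ) * ιℕ (μ C j) * α μ
  ... | no j≰n = trans (Cpoly-> (ℕP.≰⇒> j≰n))
    (sym (Σ<-≈0 (suc n) λ μ μ<1+n → x*nCk*y≈0 _ _ (ℕP.<-≤-trans μ<1+n (ℕP.≰⇒> j≰n))))

  Cnk≈Σbinom : ∀ n k i → Cnk n k i ≈ Σ< (suc n) (λ μ → ιℕ (n C μ) * α μ * ιℤ (binom ((k ℤ.- + n) ℤ.+ + μ) i))
  Cnk≈Σbinom n k i = begin
    Σ< (suc i) (λ j → Cpoly n j * b j)
      ≈⟨ Σ<-cong (suc i) (λ j _ → trans (*-congʳ (Cpoly≈Σ n j)) (*-distribʳ-Σ< (suc n) _ _)) ⟩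
    Σ< (suc i) (λ j → Σ< (suc n) (λ μ → ιℕ (n C μ) * ιℕ (μ C j) * α μ * b j))
      ≈⟨ Σ<-swap (suc i) (suc n) _ ⟩
    Σ< (suc n) (λ μ → Σ< (suc i) (λ j → ιℕ (n C μ) * ιℕ (μ C j) * α μ * b j))
      ≈⟨ Σ<-cong (suc n) (λ μ _ → trans (Σ<-cong (suc i) (λ j _ → regroup _ _ _ _)) (sym (*-distribˡ-Σ< (suc i) _ _))) ⟩
    Σ< (suc n) (λ μ → ιℕ (n C μ) * α μ * Σ< (suc i) (λ j → ιℕ (μ C j) * b j))
      ≈⟨ Σ<-cong (suc n) (λ μ _ → *-congˡ (vandermonde-gbinom μ)) ⟩
    Σ< (suc n) (λ μ → ιℕ (n C μ) * α μ * ιℤ (binom (d ℤ.+ + μ) i)) ∎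
    where
    d : ℤ
    d = k ℤ.- + n
    b : ℕ → Carrier
    b j = ιℤ (gbinom d (i ℕ.∸ j))
    regroup : ∀ x y z w → x * y * z * w ≈ (x * z) * (y * w)
    regroup x y z w = trans (*-congʳ (xy∙z≈xz∙y x y z)) (*-assoc (x * z) y w)
    vandermonde-gbinom : ∀ μ → Σ< (suc i) (λ j → ιℕ (μ C j) * b j) ≈ ιℤ (binom (d ℤ.+ + μ) i)
    vandermonde-gbinom μ = trans (Σ<-cong (suc i) (λ j _ → *-congˡ (reflexive (≡.cong ιℤ (gbinom≡binom d (i ℕ.∸ j))))))
                           (vandermonde μ d i)

  at1+x-G≈Σbinom : ∀ n k i → at1+x (G n k) i ≈ Σ< (suc n) (λ μ → ιℕ (n C μ) * α μ * ιℤ (binom ((k ℤ.- + n) ℤ.+ + μ) i))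
  at1+x-G≈Σbinom n k i = begin
    at1+x (G n k) i
      ≈⟨ at1+x-map-applyUpTo (λ ν → A n ν , k ℤ.- + ν) (λ ν → ν) (suc n) i ⟩
    Σ< (suc n) (λ ν → A n ν * ιℤ (gbinom (k ℤ.- + ν) i))
      ≈⟨ Σ<-reverse (suc n) _ ⟩
    Σ< (suc n) (λ μ → A n (n ℕ.∸ μ) * ιℤ (gbinom (k ℤ.- + (n ℕ.∸ μ)) i))
      ≈⟨ Σ<-cong (suc n) (λ μ μ<1+n → reindex (ℕP.≤-pred μ<1+n)) ⟩
    Σ< (suc n) (λ μ → ιℕ (n C μ) * α μ * ιℤ (binom ((k ℤ.- + n) ℤ.+ + μ) i)) ∎
    where
    reindex : ∀ {μ} → μ ≤ n → A n (n ℕ.∸ μ) * ιℤ (gbinom (k ℤ.- + (n ℕ.∸ μ)) i)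
                             ≈ ιℕ (n C μ) * α μ * ιℤ (binom ((k ℤ.- + n) ℤ.+ + μ) i)
    reindex μ≤n = *-cong
      (*-cong (reflexive (≡.cong ιℕ (≡.sym (nCk≡nC[n∸k] μ≤n)))) (reflexive (≡.cong α (ℕP.m∸[m∸n]≡n μ≤n))))
      (reflexive (≡.cong ιℤ (≡.trans (gbinom≡binom _ i) (≡.cong (λ c → binom c i) (i-[n∸m]≡[i-n]+m k μ≤n)))))

  Cnk≋at1+x-G : ∀ n k → Cnk n k ≋ at1+x (G n k)
  Cnk≋at1+x-G n k i = trans (Cnk≈Σbinom n k i) (sym (at1+x-G≈Σbinom n k i))

  Cnk-taylor : ∀ n k i → ιℕ (i !) * Cnk n k i ≈ evalAt1 (derivN i (G n k))
  Cnk-taylor n k i = trans (*-congˡ (Cnk≋at1+x-G n k i)) (at1+x-taylor i (G n k))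

  Cnk-vanishes : ∀ n k → + n ℤ.≤ k → ∀ i → k ℤ.< + i → Cnk n k i ≈ 0#
  Cnk-vanishes n (+ K) (+≤+ n≤K) i (+<+ K<i) = Σ<-≈0 (suc i) term≈0
    where
    term≈0 : ∀ j → j < suc i → Cpoly n j * ιℤ (gbinom (+ K ℤ.- + n) (i ℕ.∸ j)) ≈ 0#
    term≈0 j _ with j ℕ.≤? n
    ... | no j≰n  = trans (*-congʳ (Cpoly-> (ℕP.≰⇒> j≰n))) (zeroˡ _)
    ... | yes j≤n = trans (*-congˡ (reflexive (≡.cong ιℤ binom≡0))) (zeroʳ _)
      where
      K∸n<i∸j : K ℕ.∸ n < i ℕ.∸ j
      K∸n<i∸j = ℕP.≤-<-trans (ℕP.∸-monoʳ-≤ K j≤n) (ℕP.∸-monoˡ-< K<i (ℕP.≤-trans j≤n n≤K))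
      binom≡0 : gbinom (+ K ℤ.- + n) (i ℕ.∸ j) ≡ + 0
      binom≡0 = ≡.trans (gbinom≡binom _ (i ℕ.∸ j))
                  (≡.trans (≡.cong (λ c → binom c (i ℕ.∸ j)) (+m-+n≡+[m∸n] n≤K)) (binom-> K∸n<i∸j))

  Cnk≈Σgbinom*a : ∀ n k i → i ≤ n → Cnk n k i ≈ Σ< (suc i) (λ ν → ιℤ (gbinom (k ℤ.- + n) (i ℕ.∸ ν)) * a n ν)
  Cnk≈Σgbinom*a n k i i≤n =
    Σ<-cong (suc i) (λ ν ν<1+i → trans (*-congʳ (Cpoly-≤ (ℕP.≤-trans (ℕP.≤-pred ν<1+i) i≤n))) (*-comm _ _))

  Cnk≈ΣA*C : ∀ n K r → n ≤ K → Cnk n (+ K) r ≈ Σ< (suc n) (λ ν → A n ν * ιℕ ((K ℕ.∸ ν) C r))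
  Cnk≈ΣA*C n K r n≤K = begin
    Cnk n (+ K) r
      ≈⟨ Cnk≋at1+x-G n (+ K) r ⟩
    at1+x (G n (+ K)) r
      ≈⟨ at1+x-map-applyUpTo (λ ν → A n ν , + K ℤ.- + ν) (λ ν → ν) (suc n) r ⟩
    Σ< (suc n) (λ ν → A n ν * ιℤ (gbinom (+ K ℤ.- + ν) r))
      ≈⟨ Σ<-cong (suc n) (λ ν ν<1+n → *-congˡ (reflexive (≡.cong ιℤ (gbinom-nonneg (ℕP.≤-trans (ℕP.≤-pred ν<1+n) n≤K))))) ⟩
    Σ< (suc n) (λ ν → A n ν * ιℕ ((K ℕ.∸ ν) C r)) ∎
    where
    gbinom-nonneg : ∀ {ν} → ν ≤ K → gbinom (+ K ℤ.- + ν) r ≡ + ((K ℕ.∸ ν) C r)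
    gbinom-nonneg ν≤K = ≡.trans (gbinom≡binom _ r) (≡.cong (λ c → binom c r) (+m-+n≡+[m∸n] ν≤K))

  module Symmetric (A[1-x]≋sgn·A : ∀ m → AatOneMinusX m ≋ (λ j → sgn m * A m j)) where

    ΣA*C-reflect : ∀ n K i → n ≤ K → i ≤ K →
      Σ< (suc n) (λ ν → A n ν * ιℕ ((K ℕ.∸ ν) C i)) ≈ sgn n * Σ< (suc n) (λ j → A n j * ιℕ ((K ℕ.∸ j) C (K ℕ.∸ i)))
    ΣA*C-reflect n K i n≤K i≤K = sym (begin
      sgn n * Σ< (suc n) (λ j → A n j * κ j)
        ≈⟨ *-distribˡ-Σ< (suc n) _ _ ⟩
      Σ< (suc n) (λ j → sgn n * (A n j * κ j))
        ≈⟨ Σ<-cong (suc n) (λ j _ → trans (sym (*-assoc _ _ _)) (*-congʳ (sym (A[1-x]≋sgn·A n j)))) ⟩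
      Σ< (suc n) (λ j → AatOneMinusX n j * κ j)
        ≈⟨ Σ<-cong (suc n) (λ j _ → *-distribʳ-Σ< (suc n) _ _) ⟩
      Σ< (suc n) (λ j → Σ< (suc n) (λ ν → A n ν * powS oneMinusX ν j * κ j))
        ≈⟨ Σ<-swap (suc n) (suc n) _ ⟩
      Σ< (suc n) (λ ν → Σ< (suc n) (λ j → A n ν * powS oneMinusX ν j * κ j))
        ≈⟨ Σ<-cong (suc n) (λ ν _ → trans (Σ<-cong (suc n) (λ j _ → *-assoc _ _ _)) (sym (*-distribˡ-Σ< (suc n) _ _))) ⟩
      Σ< (suc n) (λ ν → A n ν * Σ< (suc n) (λ j → powS oneMinusX ν j * κ j))
        ≈⟨ Σ<-cong (suc n) (λ ν ν<1+n → *-congˡ (Σ<-[1-x]^ν*C K n ν i (ℕP.≤-pred ν<1+n) n≤K i≤K)) ⟩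
      Σ< (suc n) (λ ν → A n ν * ιℕ ((K ℕ.∸ ν) C i)) ∎)
      where
      κ : ℕ → Carrier
      κ j = ιℕ ((K ℕ.∸ j) C (K ℕ.∸ i))

    Cnk-palindromic : ∀ n K → n ≤ K → Cnk n (+ K) ≋ (λ i → sgn n * reflect K (Cnk n (+ K)) i)
    Cnk-palindromic n K n≤K i with i ℕ.≤? K
    ... | yes i≤K = begin
      Cnk n (+ K) i                                 ≈⟨ Cnk≈ΣA*C n K i n≤K ⟩
      Σ< (suc n) (λ ν → A n ν * ιℕ ((K ℕ.∸ ν) C i)) ≈⟨ ΣA*C-reflect n K i n≤K i≤K ⟩
      sgn n * Σ< (suc n) (λ j → A n j * ιℕ ((K ℕ.∸ j) C (K ℕ.∸ i)))
                                                    ≈⟨ *-congˡ (Cnk≈ΣA*C n K (K ℕ.∸ i) n≤K) ⟨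
      sgn n * Cnk n (+ K) (K ℕ.∸ i)                 ≡⟨ ≡.cong (sgn n *_) (if-≤ᵇ-of-≤ i≤K) ⟨
      sgn n * reflect K (Cnk n (+ K)) i             ∎
    ... | no i≰K = begin
      Cnk n (+ K) i                                 ≈⟨ Cnk-vanishes n (+ K) (+≤+ n≤K) i (+<+ (ℕP.≰⇒> i≰K)) ⟩
      0#                                            ≈⟨ zeroʳ (sgn n) ⟨
      sgn n * 0#                                    ≡⟨ ≡.cong (sgn n *_) (if-≤ᵇ-of-> (ℕP.≰⇒> i≰K)) ⟨
      sgn n * reflect K (Cnk n (+ K)) i             ∎

    Cnk-middle≈0 : TorsionFree → ∀ n h → n ≤ 2 ℕ.* h → n ℕ.% 2 ≡ 1 → Cnk n (+ (2 ℕ.* h)) h ≈ 0#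
    Cnk-middle≈0 torsionFree n h n≤2h odd = x≈-x⇒x≈0 torsionFree (begin
      Cnk n (+ (2 ℕ.* h)) h                               ≈⟨ Cnk-palindromic n (2 ℕ.* h) n≤2h h ⟩
      sgn n * reflect (2 ℕ.* h) (Cnk n (+ (2 ℕ.* h))) h   ≡⟨ ≡.cong (sgn n *_) (if-≤ᵇ-of-≤ (ℕP.m≤m+n h (h ℕ.+ 0))) ⟩
      sgn n * Cnk n (+ (2 ℕ.* h)) (2 ℕ.* h ℕ.∸ h)         ≡⟨ ≡.cong (λ m → sgn n * Cnk n (+ (2 ℕ.* h)) m) 2h∸h≡h ⟩
      sgn n * Cnk n (+ (2 ℕ.* h)) h                       ≈⟨ *-congʳ (sgn-odd n odd) ⟩
      - 1# * Cnk n (+ (2 ℕ.* h)) h                        ≈⟨ -1*x≈-x _ ⟩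
      - Cnk n (+ (2 ℕ.* h)) h                             ∎)
      where
      2h∸h≡h : 2 ℕ.* h ℕ.∸ h ≡ h
      2h∸h≡h = ≡.trans (ℕP.m+n∸m≡n h (h ℕ.+ 0)) (ℕP.+-identityʳ h)

-- imported only now: ℕ's _*_ would clash with the ring multiplication in the modules above
open import Data.Nat using (_%_; _*_)

theorem2p6 : ∀ {c l} (R : CommutativeRing c l) →
    let open CommutativeRing R renaming (_*_ to _·_) in
    let open Series R in
    TorsionFree → (α : ℕ → Carrier) →
    let open Paper α in
    (∀ n k → Cnk n k ≋ at1+x (G n k))
    × (∀ n k → + n ℤ.≤ k → ∀ i → k ℤ.< + i → Cnk n k i ≈ 0#)
    × (∀ n k i → i ≤ n → + i ℤ.≤ k →
         (ιℕ (i !) · Cnk n k i ≈ evalAt1 (derivN i (G n k)))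
         × (Cnk n k i ≈ Σ< (ℕ.suc i) (λ ν → ιℤ (gbinom (k ℤ.- + n) (i ℕ.∸ ν)) · a n ν)))
    × ((∀ m → AatOneMinusX m ≋ (λ j → sgn m · A m j)) →
         (∀ n K → n ≤ K → Cnk n (+ K) ≋ (λ i → sgn n · reflect K (Cnk n (+ K)) i))
         × (∀ n h → n ≤ 2 * h → n % 2 ≡ 1 → Cnk n (+ (2 * h)) h ≈ 0#))
theorem2p6 R torsionFree α =
  Cnk≋at1+x-G ,
  Cnk-vanishes ,
  (λ n k i i≤n _ → Cnk-taylor n k i , Cnk≈Σgbinom*a n k i i≤n) ,
  λ A[1-x]≋sgn·A → let open Symmetric A[1-x]≋sgn·A in Cnk-palindromic , Cnk-middle≈0 torsionFree
  where
  open PaperProperties R α
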